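{- For any integers $2\leq r\leq s$, $dom^+_{maj}(K_{r,s})=4-n$, where $n=r+s$.
   Context: $K_{r,s}$ is the complete bipartite graph with parts of sizes $r$ and $s$. Digraphs are finite, without loops or multiple arcs. For a digraph $D=(V,A)$ and $u\in V$, $N^+[u]=\{u\}\cup\{v: uv\in A\}$; for $f:V\to\{ -1,1\}$ and $X\subseteq V$, $f(X)=\sum_{v\in X}f(v)$. A majority out-dominating function (MODF) of $D$ is $f:V\to\{ -1,1\}$ with $|\{v: f(N^+[v])\geq1\}|\geq|V|/2$; its weight is $f(V)$; $\gamma^+_{maj}(D)$ is the minimum weight of a MODF. An orientation of a graph $G$ is a digraph obtained by replacing each edge $uv$ by exactly one of the arcs $uv$, $vu$. $dom^+_{maj}(G)$ is the minimum of $\gamma^+_{maj}(D)$ over all orientations $D$ of $G$. -}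

module Defs where

open import Data.Bool using (Bool; true; false; if_then_else_; _xor_)
open import Data.Nat as ℕ using (ℕ; zero; suc)
open import Data.Fin using (Fin; zero; suc; splitAt)
open import Data.Sum using (_⊎_; inj₁; inj₂)
open import Data.Product using (_×_; Σ; ∃; _,_)
open import Data.Integer as ℤ using (ℤ; +_; -[1+_])
open import Relation.Nullary using (does)
open import Relation.Binary.PropositionalEquality using (_≡_)

Graph : ℕ → Set
Graph n = Fin n → Fin n → Bool

-- A digraph on vertex set Fin n, given by its Boolean arc relation
-- (arc u v ≡ true means uv ∈ A).  Multiple arcs are impossible in this encoding.
Digraph : ℕ → Set
Digraph n = Fin n → Fin n → Bool

-- Complete bipartite graph K_{r,s}: vertices Fin (r + s); the first r form one
-- part, the last s the other; u,v adjacent iff they lie in different parts.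
inFirstPart : ∀ {r s} → Fin (r ℕ.+ s) → Bool
inFirstPart {r} {s} u with splitAt r {s} u
... | inj₁ _ = true
... | inj₂ _ = false

K : (r s : ℕ) → Graph (r ℕ.+ s)
K r s u v = inFirstPart {r} {s} u xor inFirstPart {r} {s} v

IsOrientation : ∀ {n} → Graph n → Digraph n → Set
IsOrientation G D =
  (∀ u v → G u v ≡ true →
     (D u v ≡ true × D v u ≡ false) ⊎ (D u v ≡ false × D v u ≡ true))
  × (∀ u v → D u v ≡ true → G u v ≡ true)

sumFin : ∀ {n} → (Fin n → ℤ) → ℤ
sumFin {zero} f = + 0
sumFin {suc n} f = f zero ℤ.+ sumFin (λ i → f (suc i))

countFin : ∀ {n} → (Fin n → Bool) → ℕ
countFin {zero} p = 0
countFin {suc n} p = (if p zero then 1 else 0) ℕ.+ countFin (λ i → p (suc i))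

data PM : Set where
  plus minus : PM

val : PM → ℤ
val plus = + 1
val minus = -[1+ 0 ]

closedOutSum : ∀ {n} → Digraph n → (Fin n → PM) → Fin n → ℤ
closedOutSum D f u = val (f u) ℤ.+ sumFin (λ v → if D u v then val (f v) else + 0)

weight : ∀ {n} → (Fin n → PM) → ℤ
weight f = sumFin (λ v → val (f v))

-- f is a majority out-dominating function of D:
-- |{v : f(N⁺[v]) ≥ 1}| ≥ |V|/2, i.e. 2·|{…}| ≥ n.
IsMODF : ∀ {n} → Digraph n → (Fin n → PM) → Set
IsMODF {n} D f =
  n ℕ.≤ 2 ℕ.* countFin (λ v → does (+ 1 ℤ.≤? closedOutSum D f v))

-- dom⁺_maj(G) = k : k is the minimum of weight f over all orientations D of G
-- and all MODFs f of D (min over D of γ⁺_maj(D) = min over pairs (D,f)).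
DomMajIs : ∀ {n} → Graph n → ℤ → Set
DomMajIs {n} G k =
  (Σ (Digraph n) λ D → IsOrientation G D ×
     Σ (Fin n → PM) λ f → IsMODF D f × weight f ≡ k)
  × (∀ (D : Digraph n) → IsOrientation G D →
       ∀ (f : Fin n → PM) → IsMODF D f → k ℤ.≤ weight f)

-- Lower bound: if at most one vertex is labelled +1, a vertex labelled -1 has closed
-- out-sum at most -1 + 1 = 0, so only the (at most one) +1 vertex can be dominated,
-- which is not a majority once n ≥ 3.  Hence f has at least two +1 vertices and
-- weight f = 2·#(+1) - n ≥ 4 - n; this holds for every digraph, not only orientations of K_{r,s}.
-- Upper bound: label two vertices of the first part +1 and make them sinks; every vertex of
-- the second part points to both, so the two sinks and all s ≥ n/2 second-part vertices are dominated.
module Submission where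

open import Defs
open import Data.Nat using (ℕ; _≤_)
open import Data.Integer using (+_; _-_)

open import Data.Bool using (Bool; true; false; T; if_then_else_; _xor_; not; _∧_; _∨_)
open import Data.Bool.Properties using (T-not-≡)
open import Data.Fin using (Fin; zero; suc; splitAt)
open import Data.Integer as ℤ using (ℤ; -[1+_]; +≤+; -≤+)
import Data.Integer.Properties as ℤₚ
open import Data.Integer.Tactic.RingSolver using (solve-∀)
open import Data.Nat as ℕ using (zero; suc; z≤n; s≤s)
import Data.Nat.Properties as ℕₚ
open import Data.Product using (_×_; _,_)
open import Data.Sum using (_⊎_; inj₁; inj₂)
open import Data.Unit using (tt)
open import Function using (_∘_; Equivalence)
open import Relation.Binary.PropositionalEquality using (_≡_; refl; sym; trans; cong; cong₂; module ≡-Reasoning)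
open import Relation.Nullary using (Dec; does; yes; no; contradiction)

does-sound : ∀ {A : Set} (a? : Dec A) → T (does a?) → A
does-sound (yes a) _ = a

does-complete : ∀ {A : Set} (a? : Dec A) → A → T (does a?)
does-complete (yes _)  _ = tt
does-complete (no ¬a) a = ¬a a

sumFin-mono : ∀ {n} {g h : Fin n → ℤ} → (∀ i → g i ℤ.≤ h i) → sumFin g ℤ.≤ sumFin h
sumFin-mono {zero}  g≤h = ℤₚ.≤-refl
sumFin-mono {suc n} g≤h = ℤₚ.+-mono-≤ (g≤h zero) (sumFin-mono (g≤h ∘ suc))

sumFin-indicator : ∀ {n} (p : Fin n → Bool) → sumFin (λ i → + (if p i then 1 else 0)) ≡ + countFin p
sumFin-indicator {zero}  p = refl
sumFin-indicator {suc n} p = cong (ℤ._+_ (+ (if p zero then 1 else 0))) (sumFin-indicator (p ∘ suc))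

countFin-cong : ∀ {n} {p q : Fin n → Bool} → (∀ i → p i ≡ q i) → countFin p ≡ countFin q
countFin-cong {zero}  p≡q = refl
countFin-cong {suc n} p≡q = cong₂ ℕ._+_ (cong (λ b → if b then 1 else 0) (p≡q zero)) (countFin-cong (p≡q ∘ suc))

countFin-mono : ∀ {n} {p q : Fin n → Bool} → (∀ i → T (p i) → T (q i)) → countFin p ≤ countFin q
countFin-mono {zero} p⇒q = z≤n
countFin-mono {suc n} {p} {q} p⇒q with p zero | q zero | p⇒q zero
... | true  | true  | _   = s≤s (countFin-mono (p⇒q ∘ suc))
... | true  | false | p⇒q₀ with () ← p⇒q₀ tt
... | false | true  | _   = ℕₚ.m≤n⇒m≤1+n (countFin-mono (p⇒q ∘ suc))
... | false | false | _   = countFin-mono (p⇒q ∘ suc)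

countFin-true : ∀ {n} → countFin {n} (λ _ → true) ≡ n
countFin-true {zero}  = refl
countFin-true {suc n} = cong suc countFin-true

countFin-false : ∀ {n} → countFin {n} (λ _ → false) ≡ 0
countFin-false {zero}  = refl
countFin-false {suc n} = countFin-false {n}

sumFin-zero : ∀ {n} → sumFin {n} (λ _ → + 0) ≡ + 0
sumFin-zero {n} = trans (sumFin-indicator {n} (λ _ → false)) (cong +_ (countFin-false {n}))

isPlus : PM → Bool
isPlus plus  = true
isPlus minus = false

plusCount : ∀ {n} → (Fin n → PM) → ℕ
plusCount f = countFin (isPlus ∘ f)

weight+n≡2*plusCount : ∀ {n} (f : Fin n → PM) → weight f ℤ.+ + n ≡ + plusCount f ℤ.+ + plusCount f
weight+n≡2*plusCount {zero}  f = refl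
weight+n≡2*plusCount {suc n} f with f zero | weight+n≡2*plusCount (f ∘ suc)
... | plus  | ih = begin
  (+ 1 ℤ.+ W) ℤ.+ (+ 1 ℤ.+ + n) ≡⟨ regroup W (+ n) ⟩
  + 2 ℤ.+ (W ℤ.+ + n)           ≡⟨ cong (ℤ._+_ (+ 2)) ih ⟩
  + 2 ℤ.+ (+ c ℤ.+ + c)         ≡⟨ regroup (+ c) (+ c) ⟨
  (+ 1 ℤ.+ + c) ℤ.+ (+ 1 ℤ.+ + c) ∎
  where
  open ≡-Reasoning
  W = weight (f ∘ suc)
  c = plusCount (f ∘ suc)
  regroup : ∀ a b → (+ 1 ℤ.+ a) ℤ.+ (+ 1 ℤ.+ b) ≡ + 2 ℤ.+ (a ℤ.+ b)
  regroup = solve-∀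
... | minus | ih = trans (cancel (weight (f ∘ suc)) (+ n)) ih
  where
  cancel : ∀ a b → (-[1+ 0 ] ℤ.+ a) ℤ.+ (+ 1 ℤ.+ b) ≡ a ℤ.+ b
  cancel = solve-∀

weight≡2*plusCount-n : ∀ {n} (f : Fin n → PM) → weight f ≡ (+ plusCount f ℤ.+ + plusCount f) - + n
weight≡2*plusCount-n {n} f = begin
  weight f                  ≡⟨ ℤₚ.+-identityʳ (weight f) ⟨
  weight f ℤ.+ + 0          ≡⟨ cong (ℤ._+_ (weight f)) (ℤₚ.+-inverseʳ (+ n)) ⟨
  weight f ℤ.+ (+ n - + n)  ≡⟨ ℤₚ.+-assoc (weight f) (+ n) (ℤ.- + n) ⟨
  (weight f ℤ.+ + n) - + n  ≡⟨ cong (_- + n) (weight+n≡2*plusCount f) ⟩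
  (+ plusCount f ℤ.+ + plusCount f) - + n ∎
  where open ≡-Reasoning

outSum : ∀ {n} → Digraph n → (Fin n → PM) → Fin n → ℤ
outSum D f u = sumFin (λ v → if D u v then val (f v) else + 0)

dominated : ∀ {n} → Digraph n → (Fin n → PM) → Fin n → Bool
dominated D f v = does (+ 1 ℤ.≤? closedOutSum D f v)

outSum≤plusCount : ∀ {n} (D : Digraph n) (f : Fin n → PM) u → outSum D f u ℤ.≤ + plusCount f
outSum≤plusCount D f u = ℤₚ.≤-trans (sumFin-mono (λ v → ≤indicator (D u v) (f v)))
                                    (ℤₚ.≤-reflexive (sumFin-indicator (isPlus ∘ f)))
  where
  ≤indicator : ∀ b x → (if b then val x else + 0) ℤ.≤ + (if isPlus x then 1 else 0)
  ≤indicator true  plus  = ℤₚ.≤-refl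
  ≤indicator true  minus = -≤+
  ≤indicator false plus  = +≤+ z≤n
  ≤indicator false minus = ℤₚ.≤-refl

dominated⇒plus : ∀ {n} (D : Digraph n) (f : Fin n → PM) → plusCount f ≤ 1 →
  ∀ v → T (dominated D f v) → T (isPlus (f v))
dominated⇒plus D f few v dom with f v
... | plus  = tt
... | minus = contradiction (ℤₚ.≤-trans (does-sound (+ 1 ℤ.≤? _) dom) closedOutSum≤0) λ { (+≤+ ()) }
  where
  open ℤₚ.≤-Reasoning
  closedOutSum≤0 : -[1+ 0 ] ℤ.+ outSum D f v ℤ.≤ + 0
  closedOutSum≤0 = begin
    -[1+ 0 ] ℤ.+ outSum D f v     ≤⟨ ℤₚ.+-monoʳ-≤ -[1+ 0 ] (outSum≤plusCount D f v) ⟩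
    -[1+ 0 ] ℤ.+ + plusCount f    ≤⟨ ℤₚ.+-monoʳ-≤ -[1+ 0 ] (+≤+ few) ⟩
    + 0                           ∎

two≤plusCount : ∀ {n} → 3 ≤ n → (D : Digraph n) (f : Fin n → PM) → IsMODF D f → 2 ≤ plusCount f
two≤plusCount {n} 3≤n D f isMODF with plusCount f ℕ.≤? 1
... | no  more = ℕₚ.≰⇒> more
... | yes few  = contradiction 3≤n (ℕₚ.<⇒≱ (s≤s n≤2))
  where
  open ℕₚ.≤-Reasoning
  n≤2 : n ≤ 2
  n≤2 = begin
    n                              ≤⟨ isMODF ⟩
    2 ℕ.* countFin (dominated D f) ≤⟨ ℕₚ.*-monoʳ-≤ 2 (countFin-mono (dominated⇒plus D f few)) ⟩
    2 ℕ.* plusCount f              ≤⟨ ℕₚ.*-monoʳ-≤ 2 few ⟩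
    2                              ∎

weight-lowerBound : ∀ {n} → 3 ≤ n → (D : Digraph n) (f : Fin n → PM) → IsMODF D f → + 4 - + n ℤ.≤ weight f
weight-lowerBound {n} 3≤n D f isMODF = begin
  + 4 - + n                               ≤⟨ ℤₚ.+-monoˡ-≤ (ℤ.- + n) (+≤+ (ℕₚ.+-mono-≤ 2≤c 2≤c)) ⟩
  (+ plusCount f ℤ.+ + plusCount f) - + n ≡⟨ weight≡2*plusCount-n f ⟨
  weight f                                ∎
  where
  open ℤₚ.≤-Reasoning
  2≤c = two≤plusCount 3≤n D f isMODF

inFirstPart-suc : ∀ r s (i : Fin (r ℕ.+ s)) → inFirstPart {suc r} {s} (suc i) ≡ inFirstPart {r} {s} i
inFirstPart-suc r s i with splitAt r {s} i
... | inj₁ _ = refl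
... | inj₂ _ = refl

countFin-secondPart : ∀ r s → countFin (λ i → not (inFirstPart {r} {s} i)) ≡ s
countFin-secondPart zero    s = countFin-true
countFin-secondPart (suc r) s =
  trans (countFin-cong (cong not ∘ inFirstPart-suc r s)) (countFin-secondPart r s)

sinkArc : (inFirstᵤ inFirstᵥ sinkᵤ sinkᵥ : Bool) → Bool
sinkArc x y a b = (not x ∧ b) ∨ (x ∧ not a ∧ not y)

sinkArc-orients : ∀ x y a b → x xor y ≡ true →
  (sinkArc x y a b ≡ true × sinkArc y x b a ≡ false) ⊎ (sinkArc x y a b ≡ false × sinkArc y x b a ≡ true)
sinkArc-orients true  false false b     _ = inj₁ (refl , refl)
sinkArc-orients true  false true  b     _ = inj₂ (refl , refl)
sinkArc-orients false true  a     false _ = inj₂ (refl , refl)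
sinkArc-orients false true  a     true  _ = inj₁ (refl , refl)

sinkArc⇒xor : ∀ x y a b → (b ≡ true → y ≡ true) → sinkArc x y a b ≡ true → x xor y ≡ true
sinkArc⇒xor true  false a     b     _       _  = refl
sinkArc⇒xor false true  a     b     _       _  = refl
sinkArc⇒xor true  true  true  b     _       ()
sinkArc⇒xor true  true  false b     _       ()
sinkArc⇒xor false false a     false _       ()
sinkArc⇒xor false false a     true  sink⇒y _ with () ← sink⇒y refl

-- K_{2+m,s} with the first two vertices as sinks: every vertex of the second part points to
-- both sinks, every other vertex of the first part points to the whole second part.
module SinkPairOrientation (m s : ℕ) where

  inA : Fin (2 ℕ.+ m ℕ.+ s) → Bool
  inA = inFirstPart {2 ℕ.+ m} {s}

  isSink : Fin (2 ℕ.+ m ℕ.+ s) → Bool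
  isSink zero          = true
  isSink (suc zero)    = true
  isSink (suc (suc _)) = false

  sink⇒inA : ∀ v → isSink v ≡ true → inA v ≡ true
  sink⇒inA zero       _ = refl
  sink⇒inA (suc zero) _ = refl

  arc : Digraph (2 ℕ.+ m ℕ.+ s)
  arc u v = sinkArc (inA u) (inA v) (isSink u) (isSink v)

  arc-isOrientation : IsOrientation (K (2 ℕ.+ m) s) arc
  arc-isOrientation =
      (λ u v → sinkArc-orients (inA u) (inA v) (isSink u) (isSink v))
    , (λ u v → sinkArc⇒xor (inA u) (inA v) (isSink u) (isSink v) (sink⇒inA v))

  label : Fin (2 ℕ.+ m ℕ.+ s) → PM
  label zero          = plus
  label (suc zero)    = plus
  label (suc (suc _)) = minus

  plusCount-label : plusCount label ≡ 2
  plusCount-label = cong (2 ℕ.+_) (countFin-false {m ℕ.+ s})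

  weight-label : weight label ≡ + 4 - + (2 ℕ.+ m ℕ.+ s)
  weight-label = trans (weight≡2*plusCount-n label)
                       (cong (λ c → (+ c ℤ.+ + c) - + (2 ℕ.+ m ℕ.+ s)) plusCount-label)

  secondPart-outSum : ∀ v → inA v ≡ false → outSum arc label v ≡ + 2
  secondPart-outSum v v∉A rewrite v∉A = cong (λ z → + 1 ℤ.+ (+ 1 ℤ.+ z)) (sumFin-zero {m ℕ.+ s})

  sinkOrSecond⇒dominated : ∀ v → T (isSink v ∨ not (inA v)) → T (dominated arc label v)
  sinkOrSecond⇒dominated zero _ =
    does-complete (+ 1 ℤ.≤? _) (ℤₚ.≤-reflexive (cong (ℤ._+_ (+ 1)) (sym (sumFin-zero {2 ℕ.+ m ℕ.+ s}))))
  sinkOrSecond⇒dominated (suc zero) _ =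
    does-complete (+ 1 ℤ.≤? _) (ℤₚ.≤-reflexive (cong (ℤ._+_ (+ 1)) (sym (sumFin-zero {2 ℕ.+ m ℕ.+ s}))))
  sinkOrSecond⇒dominated v@(suc (suc _)) v∉A = does-complete (+ 1 ℤ.≤? _) (begin
    + 1                       ≤⟨ 1≤val+2 (label v) ⟩
    val (label v) ℤ.+ + 2     ≡⟨ cong (ℤ._+_ (val (label v))) (secondPart-outSum v (Equivalence.to T-not-≡ v∉A)) ⟨
    closedOutSum arc label v  ∎)
    where
    open ℤₚ.≤-Reasoning
    1≤val+2 : ∀ x → + 1 ℤ.≤ val x ℤ.+ + 2
    1≤val+2 plus  = +≤+ (s≤s z≤n)
    1≤val+2 minus = ℤₚ.≤-refl

  countFin-sinkOrSecond : countFin (λ v → isSink v ∨ not (inA v)) ≡ 2 ℕ.+ s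
  countFin-sinkOrSecond = cong (2 ℕ.+_) (trans (countFin-cong shift) (countFin-secondPart m s))
    where
    shift : ∀ i → not (inA (suc (suc i))) ≡ not (inFirstPart {m} {s} i)
    shift i = cong not (trans (inFirstPart-suc (suc m) s (suc i)) (inFirstPart-suc m s i))

  label-isMODF : 2 ℕ.+ m ≤ s → IsMODF arc label
  label-isMODF 2+m≤s = begin
    2 ℕ.+ m ℕ.+ s                      ≤⟨ ℕₚ.+-monoˡ-≤ s 2+m≤s ⟩
    s ℕ.+ s                            ≡⟨ cong (s ℕ.+_) (ℕₚ.+-identityʳ s) ⟨
    2 ℕ.* s                            ≤⟨ ℕₚ.*-monoʳ-≤ 2 (ℕₚ.m≤n+m s 2) ⟩
    2 ℕ.* (2 ℕ.+ s)                    ≡⟨ cong (2 ℕ.*_) countFin-sinkOrSecond ⟨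
    2 ℕ.* countFin (λ v → isSink v ∨ not (inA v)) ≤⟨ ℕₚ.*-monoʳ-≤ 2 (countFin-mono sinkOrSecond⇒dominated) ⟩
    2 ℕ.* countFin (dominated arc label) ∎
    where open ℕₚ.≤-Reasoning

proposition4p8 : (r s : ℕ) → 2 ≤ r → r ≤ s →
    DomMajIs (K r s) (+ 4 - + (r Data.Nat.+ s))
proposition4p8 (suc (suc m)) s (s≤s (s≤s _)) r≤s =
    (arc , arc-isOrientation , label , label-isMODF r≤s , weight-label)
  , λ D _ f isMODF → weight-lowerBound 3≤n D f isMODF
  where
  open SinkPairOrientation m s
  3≤n : 3 ≤ 2 ℕ.+ m ℕ.+ s
  3≤n = s≤s (s≤s (ℕₚ.≤-trans (ℕₚ.≤-trans (s≤s z≤n) r≤s) (ℕₚ.m≤n+m s m)))
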